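{- Let $A=\{a_1<\dots<a_m\}$, $B=\{b_1<\dots<b_n\}$, $O=A\times B$, $X$ the set of monotone non-decreasing maps $A\to B$, $Y$ the set of monotone non-decreasing maps $B\to A$, and $G(x,y)=\{(a,b)\in O: x(a)=b,\ y(b)=a\}$. Let $W\subseteq O$. If for each $y\in Y$ there exists $x\in X$ such that $W\cap G(x,y)\neq\emptyset$, then there exists $x\in X$ such that $G(x,y)\subseteq W$ for every $y\in Y$. -}

module Defs where

open import Data.Nat using (ℕ)
open import Data.Fin using (Fin; _≤_)
open import Data.Bool using (Bool; true)
open import Data.Product using (Σ; _×_)
open import Relation.Binary.PropositionalEquality using (_≡_)

-- A totally ordered finite set {a₁ < … < aₘ} is modelled by Fin m with its order.

Monotone : {m n : ℕ} → (Fin m → Fin n) → Set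
Monotone {m} f = (i j : Fin m) → i ≤ j → f i ≤ f j

MonMap : ℕ → ℕ → Set
MonMap m n = Σ (Fin m → Fin n) Monotone

SubsetO : ℕ → ℕ → Set
SubsetO m n = Fin m → Fin n → Bool

_∈ᴼ_ : {m n : ℕ} → Fin m × Fin n → SubsetO m n → Set
_∈ᴼ_ (a Data.Product., b) W = W a b ≡ true

InG : {m n : ℕ} → MonMap m n → MonMap n m → Fin m → Fin n → Set
InG x y a b = (Data.Product.proj₁ x a ≡ b) × (Data.Product.proj₁ y b ≡ a)

-- Walk a staircase through the grid A × B from its least corner: a cell in W
-- is recorded as a value of a map x : A → B and the walk moves to the next
-- row, a cell outside W is recorded as a value of a map y : B → A and the
-- walk moves to the next column. Either the rows run out first, and x is a
-- monotone map whose whole graph lies in W, or the columns do, and y is a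
-- monotone map whose graph misses W. In the first case G(x,y) ⊆ graph x ⊆ W
-- for every y; the second case contradicts the hypothesis.
module Submission where

open import Defs
open import Data.Nat using (ℕ; suc; z≤n; s≤s)
open import Data.Fin using (Fin; zero; suc)
open import Data.Bool using (true; false)
open import Data.Product using (Σ; _×_; _,_)
open import Data.Empty using (⊥-elim)
open import Data.Sum using (_⊎_; inj₁; inj₂)
open import Data.Vec.Functional using (_∷_)
open import Function using (_∘_)
open import Relation.Nullary using (¬_)
open import Relation.Binary.PropositionalEquality using (_≡_; refl; sym; trans; subst)

private
  variable
    m n : ℕ

GraphWithin : SubsetO m n → MonMap m n → Set
GraphWithin W (x , _) = ∀ a → W a (x a) ≡ true

TransposedGraphAvoids : SubsetO m n → MonMap n m → Set
TransposedGraphAvoids W (y , _) = ∀ b → W (y b) b ≡ false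

zero∷-monotone : {f : Fin m → Fin (suc n)} → Monotone f → Monotone (zero ∷ f)
zero∷-monotone f-mono zero    _       _         = z≤n
zero∷-monotone f-mono (suc i) (suc j) (s≤s i≤j) = f-mono i j i≤j

suc∘-monotone : {f : Fin m → Fin n} → Monotone f → Monotone (suc ∘ f)
suc∘-monotone f-mono i j i≤j = s≤s (f-mono i j i≤j)

graphWithin-⊎-transposedGraphAvoids : (m n : ℕ) (W : SubsetO m n) →
  Σ (MonMap m n) (GraphWithin W) ⊎ Σ (MonMap n m) (TransposedGraphAvoids W)
graphWithin-⊎-transposedGraphAvoids ℕ.zero n W = inj₁ (((λ ()) , λ ()) , λ ())
graphWithin-⊎-transposedGraphAvoids (suc m) ℕ.zero W = inj₂ (((λ ()) , λ ()) , λ ())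
graphWithin-⊎-transposedGraphAvoids (suc m) (suc n) W with W zero zero in W₀₀
... | true with graphWithin-⊎-transposedGraphAvoids m (suc n) (W ∘ suc)
...   | inj₁ ((x , x-mono) , within) =
        inj₁ ((zero ∷ x , zero∷-monotone x-mono) , λ { zero → W₀₀ ; (suc a) → within a })
...   | inj₂ ((y , y-mono) , avoids) = inj₂ ((suc ∘ y , suc∘-monotone y-mono) , avoids)
graphWithin-⊎-transposedGraphAvoids (suc m) (suc n) W | false
  with graphWithin-⊎-transposedGraphAvoids (suc m) n (λ a b → W a (suc b))
... | inj₁ ((x , x-mono) , within) = inj₁ ((suc ∘ x , suc∘-monotone x-mono) , within)
... | inj₂ ((y , y-mono) , avoids) =
      inj₂ ((zero ∷ y , zero∷-monotone y-mono) , λ { zero → W₀₀ ; (suc b) → avoids b })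

graphWithin⇒G⊆W : (W : SubsetO m n) (x : MonMap m n) → GraphWithin W x →
  (y : MonMap n m) (a : Fin m) (b : Fin n) → InG x y a b → (a , b) ∈ᴼ W
graphWithin⇒G⊆W W x within y a b (xa≡b , _) = subst (λ b → W a b ≡ true) xa≡b (within a)

transposedGraphAvoids⇒G∩W≡∅ : (W : SubsetO m n) (y : MonMap n m) → TransposedGraphAvoids W y →
  (x : MonMap m n) (a : Fin m) (b : Fin n) → InG x y a b → ¬ ((a , b) ∈ᴼ W)
transposedGraphAvoids⇒G∩W≡∅ W y avoids x a b (_ , refl) Wab with () ← trans (sym Wab) (avoids b)

theorem1 : (m n : ℕ) → (W : SubsetO (suc m) (suc n)) →
    ((y : MonMap (suc n) (suc m)) → Σ (MonMap (suc m) (suc n)) λ x →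
       Σ (Fin (suc m) × Fin (suc n)) λ p → InG x y (Data.Product.proj₁ p) (Data.Product.proj₂ p) × (p ∈ᴼ W)) →
    Σ (MonMap (suc m) (suc n)) λ x → (y : MonMap (suc n) (suc m)) →
      (a : Fin (suc m)) (b : Fin (suc n)) → InG x y a b → (a , b) ∈ᴼ W
theorem1 m n W meets with graphWithin-⊎-transposedGraphAvoids (suc m) (suc n) W
... | inj₁ (x , within) = x , graphWithin⇒G⊆W W x within
... | inj₂ (y , avoids) with meets y
...   | x , (a , b) , a,b∈G , a,b∈W =
        ⊥-elim (transposedGraphAvoids⇒G∩W≡∅ W y avoids x a b a,b∈G a,b∈W)
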